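{- Let $n\geqslant 5$ and let $u$ be an odd vertex of $\text{CQ}_n$. Then the $P_4$-graph of $N(u)$ (with respect to $G=\text{CQ}_n$) contains no complete subgraph $K_4$.
   Context: Two 2-bit strings $x_2x_1$ and $y_2y_1$ are pair related, written $x_2x_1\sim y_2y_1$, iff $(x_2x_1,y_2y_1)\in\{(00,00),(10,10),(01,11),(11,01)\}$. The $n$-dimensional crossed cube $\text{CQ}_n$ has as vertices all binary strings $u=u_{n-1}\ldots u_0$ of length $n$. Two vertices $u,v$ are adjacent iff there is an index $x$ with $0\leqslant x\leqslant n-1$ such that: (1) $v_x\neq u_x$; (2) if $x$ is odd, $v_{x-1}=u_{x-1}$; (3) $v_i=u_i$ for all $i>x$; (4) $u_{2i+1}u_{2i}\sim v_{2i+1}v_{2i}$ for all $0\leqslant i\leqslant\lfloor x/2\rfloor-1$. A vertex $u$ is even (resp. odd) if $u_0=0$ (resp. $u_0=1$). $N(u)$ is the set of neighbours of $u$. A $P_4$ from $x$ to $y$ in $G$ is a path in $G$ on four distinct vertices with endpoints $x$ and $y$. The $P_4$-graph of a set $S\subseteq V(G)$ is the graph $H$ with $V(H)=S$ in which $x,y\in S$ are adjacent iff there is a $P_4$ from $x$ to $y$ in $G$. -}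

module Defs where

open import Data.Bool using (Bool; true; false)
open import Data.Nat using (ℕ; zero; suc; _*_; _+_; _≤_; _<_)
open import Data.Vec using (Vec; []; _∷_)
open import Data.Product using (Σ; _×_; ∃-syntax)
open import Relation.Binary.PropositionalEquality using (_≡_; _≢_)

-- A vertex u = u_{n-1} … u_0 of CQ_n is represented as a vector of length n
-- listing its bits from position 0 upward:  u_0 ∷ u_1 ∷ … ∷ u_{n-1} ∷ [].
Vertex : ℕ → Set
Vertex n = Vec Bool n

-- bit u i = u_i.  (Out-of-range positions give false; they are never used
-- below, since every position mentioned is < n.)
bit : ∀ {n} → Vec Bool n → ℕ → Bool
bit []      _       = false
bit (b ∷ u) zero    = b
bit (b ∷ u) (suc i) = bit u i

data PairRel : Bool → Bool → Bool → Bool → Set where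
  00∼00 : PairRel false false false false
  10∼10 : PairRel true  false true  false
  01∼11 : PairRel false true  true  true
  11∼01 : PairRel true  true  false true

-- Adjacency in CQ_n (the definition from the paper, with index x < n).
-- Condition (4) "for all 0 ≤ i ≤ ⌊x/2⌋ - 1" is equivalent to 2i+2 ≤ x.
Adj : (n : ℕ) → Vertex n → Vertex n → Set
Adj n u v = ∃[ x ] (x < n
  × bit v x ≢ bit u x
  × (∀ k → x ≡ suc (2 * k) → bit v (2 * k) ≡ bit u (2 * k))
  × (∀ i → x < i → i < n → bit v i ≡ bit u i)
  × (∀ i → 2 * i + 2 ≤ x →
       PairRel (bit u (suc (2 * i))) (bit u (2 * i))
               (bit v (suc (2 * i))) (bit v (2 * i))))

Odd : ∀ {n} → Vertex n → Set
Odd u = bit u 0 ≡ true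

P4 : (n : ℕ) → Vertex n → Vertex n → Set
P4 n x y = ∃[ a ] ∃[ b ]
  ( x ≢ a × x ≢ b × x ≢ y × a ≢ b × a ≢ y × b ≢ y
  × Adj n x a × Adj n a b × Adj n b y)

P4GraphOfNeighbourhoodHasK4 : (n : ℕ) → Vertex n → Set
P4GraphOfNeighbourhoodHasK4 n u = ∃[ a ] ∃[ b ] ∃[ c ] ∃[ d ]
  ( Adj n u a × Adj n u b × Adj n u c × Adj n u d
  × a ≢ b × a ≢ c × a ≢ d × b ≢ c × b ≢ d × c ≢ d
  × P4 n a b × P4 n a c × P4 n a d × P4 n b c × P4 n b d × P4 n c d)

-- Every vertex v has exactly one neighbour along each dimension x.  On the
-- lowest 2-bit pair it flips the low bit (x = 0), flips the high bit (x = 1),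
-- or adds the low bit to the high bit (x ≥ 2); in the last case it acts on the
-- remaining bits as the neighbour along x - 2 in CQ_{n-2}.
--
-- Four distinct neighbours of u lie along four distinct dimensions, so two of
-- them, p and q, lie along dimensions ≥ 2.  A P₄ from p to q closes a walk of
-- length 5 through u.  Since u is odd, tracking the lowest pair around this
-- walk forces its middle three edges to lie along 0, some x ≥ 2, 0; the
-- remaining bits then form a triangle in CQ_{n-2}, and crossed cubes have no
-- triangles.
module Submission where

open import Defs
open import Data.Bool using (Bool; true; false; not; _xor_)
open import Data.Bool.Properties
  using (not-¬; ¬-not; not-involutive; not-distribʳ-xor; xor-assoc; xor-same)
open import Data.Empty using (⊥-elim)
open import Data.Nat using (ℕ; zero; suc; _+_; _*_; _≤_; _<_; z≤n; s≤s)
open import Data.Nat.Properties using (*-suc)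
open import Data.Product using (_×_; _,_; proj₁; ∃-syntax)
open import Data.Sum using (_⊎_; inj₁; inj₂)
open import Data.Vec using (Vec; []; _∷_)
open import Data.Vec.Properties using (∷-injectiveˡ; ∷-injectiveʳ)
open import Function using (_∘_)
open import Relation.Binary.PropositionalEquality
  using (_≡_; _≢_; refl; sym; trans; cong; cong₂; subst)
open import Relation.Nullary using (¬_)

b≢not : ∀ {b} → b ≢ not b
b≢not = not-¬ refl

not≢ : ∀ {b} → not b ≢ b
not≢ = b≢not ∘ sym

not³≢ : ∀ {b} → not (not (not b)) ≢ b
not³≢ {b} = not≢ ∘ trans (sym (cong not (not-involutive b)))

xor-cancelˡ : ∀ a b → a xor (a xor b) ≡ b
xor-cancelˡ a b = trans (sym (xor-assoc a a b)) (cong (_xor b) (xor-same a))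

second-≡ : ∀ {n a b c d} {xs ys : Vec Bool n} → a ∷ b ∷ xs ≡ c ∷ d ∷ ys → b ≡ d
second-≡ = ∷-injectiveˡ ∘ ∷-injectiveʳ

drop₂-≡ : ∀ {n a b c d} {xs ys : Vec Bool n} → a ∷ b ∷ xs ≡ c ∷ d ∷ ys → xs ≡ ys
drop₂-≡ = ∷-injectiveʳ ∘ ∷-injectiveʳ

bit-extensional : ∀ {n} {v w : Vertex n} → (∀ i → i < n → bit v i ≡ bit w i) → v ≡ w
bit-extensional {v = []}    {[]}    _  = refl
bit-extensional {v = _ ∷ _} {_ ∷ _} eq =
  cong₂ _∷_ (eq 0 (s≤s z≤n)) (bit-extensional (λ i i<n → eq (suc i) (s≤s i<n)))

PairRel-low : ∀ {a b c d} → PairRel a b c d → d ≡ b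
PairRel-low 00∼00 = refl
PairRel-low 10∼10 = refl
PairRel-low 01∼11 = refl
PairRel-low 11∼01 = refl

PairRel-high : ∀ {a b c d} → PairRel a b c d → c ≡ b xor a
PairRel-high 00∼00 = refl
PairRel-high 10∼10 = refl
PairRel-high 01∼11 = refl
PairRel-high 11∼01 = refl

-- Only meaningful for x < n.
neighbour : ∀ {n} → ℕ → Vertex n → Vertex n
neighbour _             []          = []
neighbour zero          (l ∷ v)     = not l ∷ v
neighbour (suc _)       (l ∷ [])    = l ∷ []
neighbour (suc zero)    (l ∷ h ∷ v) = l ∷ not h ∷ v
neighbour (suc (suc x)) (l ∷ h ∷ v) = l ∷ (l xor h) ∷ neighbour x v

AdjAlong : (n : ℕ) → ℕ → Vertex n → Vertex n → Set
AdjAlong n x u v = x < n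
  × bit v x ≢ bit u x
  × (∀ k → x ≡ suc (2 * k) → bit v (2 * k) ≡ bit u (2 * k))
  × (∀ i → x < i → i < n → bit v i ≡ bit u i)
  × (∀ i → 2 * i + 2 ≤ x →
       PairRel (bit u (suc (2 * i))) (bit u (2 * i))
               (bit v (suc (2 * i))) (bit v (2 * i)))

AdjAlong-drop₂ : ∀ {n x l h l′ h′} {v w : Vertex n} →
  AdjAlong (2 + n) (2 + x) (l ∷ h ∷ v) (l′ ∷ h′ ∷ w) → AdjAlong n x v w
AdjAlong-drop₂ {x = x} {l} {h} {l′} {h′} {v} {w} (s≤s (s≤s x<n) , differs , oddCase , above , pairs) =
  x<n , differs , oddCase′ , (λ i x<i i<n → above (2 + i) (s≤s (s≤s x<i)) (s≤s (s≤s i<n))) , pairs′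
  where
  oddCase′ : ∀ k → x ≡ suc (2 * k) → bit w (2 * k) ≡ bit v (2 * k)
  oddCase′ k x≡ = subst (λ j → bit (l′ ∷ h′ ∷ w) j ≡ bit (l ∷ h ∷ v) j) (*-suc 2 k)
    (oddCase (suc k) (trans (cong (2 +_) x≡) (cong suc (sym (*-suc 2 k)))))

  pairs′ : ∀ i → 2 * i + 2 ≤ x →
    PairRel (bit v (suc (2 * i))) (bit v (2 * i)) (bit w (suc (2 * i))) (bit w (2 * i))
  pairs′ i le = subst (λ j → PairRel (bit (l ∷ h ∷ v) (suc j)) (bit (l ∷ h ∷ v) j)
                                     (bit (l′ ∷ h′ ∷ w) (suc j)) (bit (l′ ∷ h′ ∷ w) j))
    (*-suc 2 i) (pairs (suc i) (subst (λ j → j + 2 ≤ 2 + x) (sym (*-suc 2 i)) (s≤s (s≤s le))))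

AdjAlong⇒≡neighbour : ∀ {n x} {v w : Vertex n} → AdjAlong n x v w → w ≡ neighbour x v
AdjAlong⇒≡neighbour {v = []} {[]} (() , _)
AdjAlong⇒≡neighbour {x = zero} {_ ∷ _} {_ ∷ _} (_ , differs , _ , above , _) =
  cong₂ _∷_ (¬-not differs) (bit-extensional λ i i<n → above (suc i) (s≤s z≤n) (s≤s i<n))
AdjAlong⇒≡neighbour {x = suc _} {_ ∷ []} {_ ∷ []} (s≤s () , _)
AdjAlong⇒≡neighbour {x = suc zero} {_ ∷ _ ∷ _} {_ ∷ _ ∷ _} (_ , differs , oddCase , above , _) =
  cong₂ _∷_ (oddCase 0 refl) (cong₂ _∷_ (¬-not differs)
    (bit-extensional λ i i<n → above (2 + i) (s≤s (s≤s z≤n)) (s≤s (s≤s i<n))))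
AdjAlong⇒≡neighbour {x = suc (suc _)} {_ ∷ _ ∷ _} {_ ∷ _ ∷ _} adj@(_ , _ , _ , _ , pairs) =
  cong₂ _∷_ (PairRel-low lowPair)
    (cong₂ _∷_ (PairRel-high lowPair) (AdjAlong⇒≡neighbour (AdjAlong-drop₂ adj)))
  where lowPair = pairs 0 (s≤s (s≤s z≤n))

Adj⇒≡neighbour : ∀ {n} {v w : Vertex n} → Adj n v w → ∃[ x ] (x < n × w ≡ neighbour x v)
Adj⇒≡neighbour (x , adj) = x , proj₁ adj , AdjAlong⇒≡neighbour adj

AdjAlong-≢⇒dimension-≢ : ∀ {n x y} (u : Vertex n) {p q : Vertex n} →
  AdjAlong n x u p → AdjAlong n y u q → p ≢ q → x ≢ y
AdjAlong-≢⇒dimension-≢ u {p} {q} up uq p≢q refl =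
  p≢q (trans (AdjAlong⇒≡neighbour {v = u} {p} up) (sym (AdjAlong⇒≡neighbour {v = u} {q} uq)))

neighbour-≢ : ∀ {n x} (v : Vertex n) → x < n → neighbour x v ≢ v
neighbour-≢ {x = zero}        (_ ∷ _)     _                 = not≢ ∘ ∷-injectiveˡ
neighbour-≢ {x = suc _}       (_ ∷ [])    (s≤s ())
neighbour-≢ {x = suc zero}    (_ ∷ _ ∷ _) _                 = not≢ ∘ second-≡
neighbour-≢ {x = suc (suc _)} (_ ∷ _ ∷ v) (s≤s (s≤s x<n))   = neighbour-≢ v x<n ∘ drop₂-≡

-- Split on the classes 0, 1, ≥ 2 of the three dimensions: every case but the
-- last is refuted on the lowest pair or by `neighbour-≢` on the remaining bits.
no-triangle : ∀ {n} x y z (v : Vertex n) → x < n → y < n → z < n →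
  neighbour y (neighbour x v) ≢ neighbour z v
no-triangle 0             0             0             (_ ∷ [])    _ _ _ = not≢ ∘ ∷-injectiveˡ
no-triangle (suc _)       _             _             (_ ∷ [])    (s≤s ()) _ _
no-triangle 0             (suc _)       _             (_ ∷ [])    _ (s≤s ()) _
no-triangle 0             0             (suc _)       (_ ∷ [])    _ _ (s≤s ())
no-triangle 0             0             0             (_ ∷ _ ∷ _) _ _ _ = not≢ ∘ ∷-injectiveˡ
no-triangle 0             0             1             (_ ∷ _ ∷ _) _ _ _ = b≢not ∘ second-≡
no-triangle 0             0             (suc (suc _)) (_ ∷ _ ∷ r) _ _ (s≤s (s≤s z<m)) = neighbour-≢ r z<m ∘ sym ∘ drop₂-≡
no-triangle 0             1             0             (_ ∷ _ ∷ _) _ _ _ = not≢ ∘ second-≡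
no-triangle 0             1             1             (_ ∷ _ ∷ _) _ _ _ = not≢ ∘ ∷-injectiveˡ
no-triangle 0             1             (suc (suc _)) (_ ∷ _ ∷ _) _ _ _ = not≢ ∘ ∷-injectiveˡ
no-triangle 0             (suc (suc _)) 0             (_ ∷ _ ∷ r) _ (s≤s (s≤s y<m)) _ = neighbour-≢ r y<m ∘ drop₂-≡
no-triangle 0             (suc (suc _)) 1             (_ ∷ _ ∷ _) _ _ _ = not≢ ∘ ∷-injectiveˡ
no-triangle 0             (suc (suc _)) (suc (suc _)) (_ ∷ _ ∷ _) _ _ _ = not≢ ∘ ∷-injectiveˡ
no-triangle 1             0             0             (_ ∷ _ ∷ _) _ _ _ = not≢ ∘ second-≡
no-triangle 1             0             1             (_ ∷ _ ∷ _) _ _ _ = not≢ ∘ ∷-injectiveˡ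
no-triangle 1             0             (suc (suc _)) (_ ∷ _ ∷ _) _ _ _ = not≢ ∘ ∷-injectiveˡ
no-triangle 1             1             0             (_ ∷ _ ∷ _) _ _ _ = b≢not ∘ ∷-injectiveˡ
no-triangle 1             1             1             (_ ∷ _ ∷ _) _ _ _ = not≢ ∘ second-≡
no-triangle 1             1             (suc (suc _)) (_ ∷ _ ∷ r) _ _ (s≤s (s≤s z<m)) = neighbour-≢ r z<m ∘ sym ∘ drop₂-≡
no-triangle 1             (suc (suc _)) 0             (_ ∷ _ ∷ _) _ _ _ = b≢not ∘ ∷-injectiveˡ
no-triangle 1             (suc (suc _)) 1             (_ ∷ _ ∷ r) _ (s≤s (s≤s y<m)) _ = neighbour-≢ r y<m ∘ drop₂-≡
no-triangle 1             (suc (suc _)) (suc (suc _)) (l ∷ h ∷ _) _ _ _ =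
  not≢ ∘ trans (not-distribʳ-xor l h) ∘ second-≡
no-triangle (suc (suc _)) 0             0             (_ ∷ _ ∷ r) (s≤s (s≤s x<m)) _ _ = neighbour-≢ r x<m ∘ drop₂-≡
no-triangle (suc (suc _)) 0             1             (_ ∷ _ ∷ _) _ _ _ = not≢ ∘ ∷-injectiveˡ
no-triangle (suc (suc _)) 0             (suc (suc _)) (_ ∷ _ ∷ _) _ _ _ = not≢ ∘ ∷-injectiveˡ
no-triangle (suc (suc _)) 1             0             (_ ∷ _ ∷ _) _ _ _ = b≢not ∘ ∷-injectiveˡ
no-triangle (suc (suc _)) 1             1             (_ ∷ _ ∷ r) (s≤s (s≤s x<m)) _ _ = neighbour-≢ r x<m ∘ drop₂-≡
no-triangle (suc (suc _)) 1             (suc (suc _)) (_ ∷ _ ∷ _) _ _ _ = not≢ ∘ second-≡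
no-triangle (suc (suc _)) (suc (suc _)) 0             (_ ∷ _ ∷ _) _ _ _ = b≢not ∘ ∷-injectiveˡ
no-triangle (suc (suc _)) (suc (suc _)) 1             (l ∷ _ ∷ _) _ _ _ =
  b≢not ∘ trans (sym (xor-cancelˡ l _)) ∘ second-≡
no-triangle (suc (suc x)) (suc (suc y)) (suc (suc z)) (_ ∷ _ ∷ r)
            (s≤s (s≤s x<m)) (s≤s (s≤s y<m)) (s≤s (s≤s z<m)) =
  no-triangle x y z r x<m y<m z<m ∘ drop₂-≡

-- A walk of three crossings from an odd vertex back to the same lowest pair
-- must go along 0, some dimension ≥ 2, and 0 again; the first bit already
-- refutes every case with an odd number of 0-steps.
no-odd-walk₃ : ∀ {m} b (r s : Vertex m) → (∀ y → y < m → neighbour y r ≢ s) →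
  ∀ x₂ x₃ x₄ → x₃ < 2 + m →
  neighbour x₄ (neighbour x₃ (neighbour x₂ (true ∷ b ∷ r))) ≢ true ∷ b ∷ s
no-odd-walk₃ _ _ _ _    0             0             0             _ ()
no-odd-walk₃ _ _ _ _    0             0             1             _ = not≢ ∘ second-≡
no-odd-walk₃ _ _ _ _    0             0             (suc (suc _)) _ = not≢ ∘ second-≡
no-odd-walk₃ _ _ _ _    0             1             0             _ = not≢ ∘ second-≡
no-odd-walk₃ _ _ _ _    0             1             1             _ ()
no-odd-walk₃ _ _ _ _    0             1             (suc (suc _)) _ ()
no-odd-walk₃ _ _ _ r↛s 0             (suc (suc y)) 0             (s≤s (s≤s y<m)) = r↛s y y<m ∘ drop₂-≡
no-odd-walk₃ _ _ _ _    0             (suc (suc _)) 1             _ ()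
no-odd-walk₃ _ _ _ _    0             (suc (suc _)) (suc (suc _)) _ ()
no-odd-walk₃ _ _ _ _    1             0             0             _ = not≢ ∘ second-≡
no-odd-walk₃ _ _ _ _    1             0             1             _ ()
no-odd-walk₃ _ _ _ _    1             0             (suc (suc _)) _ ()
no-odd-walk₃ _ _ _ _    1             1             0             _ ()
no-odd-walk₃ _ _ _ _    1             1             1             _ = not³≢ ∘ second-≡
no-odd-walk₃ _ _ _ _    1             1             (suc (suc _)) _ = not³≢ ∘ second-≡
no-odd-walk₃ _ _ _ _    1             (suc (suc _)) 0             _ ()
no-odd-walk₃ _ _ _ _    1             (suc (suc _)) 1             _ = not³≢ ∘ second-≡
no-odd-walk₃ _ _ _ _    1             (suc (suc _)) (suc (suc _)) _ = not³≢ ∘ second-≡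
no-odd-walk₃ _ _ _ _    (suc (suc _)) 0             0             _ = not≢ ∘ second-≡
no-odd-walk₃ _ _ _ _    (suc (suc _)) 0             1             _ ()
no-odd-walk₃ _ _ _ _    (suc (suc _)) 0             (suc (suc _)) _ ()
no-odd-walk₃ _ _ _ _    (suc (suc _)) 1             0             _ ()
no-odd-walk₃ _ _ _ _    (suc (suc _)) 1             1             _ = not³≢ ∘ second-≡
no-odd-walk₃ _ _ _ _    (suc (suc _)) 1             (suc (suc _)) _ = not³≢ ∘ second-≡
no-odd-walk₃ _ _ _ _    (suc (suc _)) (suc (suc _)) 0             _ ()
no-odd-walk₃ _ _ _ _    (suc (suc _)) (suc (suc _)) 1             _ = not³≢ ∘ second-≡
no-odd-walk₃ _ _ _ _    (suc (suc _)) (suc (suc _)) (suc (suc _)) _ = not³≢ ∘ second-≡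

no-odd-pentagon : ∀ {n} (u : Vertex n) → Odd u → ∀ {x₁ x₅} x₂ x₃ x₄ →
  2 ≤ x₁ → 2 ≤ x₅ → x₁ < n → x₃ < n → x₅ < n →
  neighbour x₄ (neighbour x₃ (neighbour x₂ (neighbour x₁ u))) ≢ neighbour x₅ u
no-odd-pentagon (true ∷ h ∷ r) refl {suc (suc y₁)} {suc (suc y₅)} x₂ x₃ x₄
                (s≤s (s≤s _)) (s≤s (s≤s _)) (s≤s (s≤s y₁<m)) x₃<n (s≤s (s≤s y₅<m)) =
  no-odd-walk₃ (not h) (neighbour y₁ r) (neighbour y₅ r)
    (λ y y<m → no-triangle y₁ y y₅ r y₁<m y<m y₅<m) x₂ x₃ x₄ x₃<n

odd-high-neighbours-¬P4 : ∀ {n x y} (u : Vertex n) {p q : Vertex n} → Odd u → 2 ≤ x → 2 ≤ y →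
  AdjAlong n x u p → AdjAlong n y u q → ¬ P4 n p q
odd-high-neighbours-¬P4 u {p} {q} odd 2≤x 2≤y up uq (c , d , _ , _ , _ , _ , _ , _ , pc , cd , dq)
  with Adj⇒≡neighbour {v = p} {c} pc | Adj⇒≡neighbour {v = c} {d} cd | Adj⇒≡neighbour {v = d} {q} dq
... | x₂ , _ , refl | x₃ , x₃<n , refl | x₄ , _ , refl =
  no-odd-pentagon u odd x₂ x₃ x₄ 2≤x 2≤y (proj₁ up) x₃<n (proj₁ uq)
    (trans (cong (neighbour x₄ ∘ neighbour x₃ ∘ neighbour x₂) (sym (AdjAlong⇒≡neighbour {v = u} {p} up)))
           (AdjAlong⇒≡neighbour {v = u} {q} uq))

2≤2+ : ∀ {k} → 2 ≤ 2 + k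
2≤2+ = s≤s (s≤s z≤n)

two-≥2-among-four-distinct : ∀ w x y z → w ≢ x → w ≢ y → w ≢ z → x ≢ y → x ≢ z → y ≢ z →
  (2 ≤ w × 2 ≤ x) ⊎ (2 ≤ w × 2 ≤ y) ⊎ (2 ≤ w × 2 ≤ z) ⊎
  (2 ≤ x × 2 ≤ y) ⊎ (2 ≤ x × 2 ≤ z) ⊎ (2 ≤ y × 2 ≤ z)
two-≥2-among-four-distinct (suc (suc _)) (suc (suc _)) _ _ _ _ _ _ _ _ = inj₁ (2≤2+ , 2≤2+)
two-≥2-among-four-distinct (suc (suc _)) _ (suc (suc _)) _ _ _ _ _ _ _ = inj₂ (inj₁ (2≤2+ , 2≤2+))
two-≥2-among-four-distinct (suc (suc _)) _ _ (suc (suc _)) _ _ _ _ _ _ = inj₂ (inj₂ (inj₁ (2≤2+ , 2≤2+)))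
two-≥2-among-four-distinct _ (suc (suc _)) (suc (suc _)) _ _ _ _ _ _ _ = inj₂ (inj₂ (inj₂ (inj₁ (2≤2+ , 2≤2+))))
two-≥2-among-four-distinct _ (suc (suc _)) _ (suc (suc _)) _ _ _ _ _ _ = inj₂ (inj₂ (inj₂ (inj₂ (inj₁ (2≤2+ , 2≤2+)))))
two-≥2-among-four-distinct _ _ (suc (suc _)) (suc (suc _)) _ _ _ _ _ _ = inj₂ (inj₂ (inj₂ (inj₂ (inj₂ (2≤2+ , 2≤2+)))))
two-≥2-among-four-distinct 0 0 _ _ w≢x _ _ _ _ _ = ⊥-elim (w≢x refl)
two-≥2-among-four-distinct 1 1 _ _ w≢x _ _ _ _ _ = ⊥-elim (w≢x refl)
two-≥2-among-four-distinct 0 _ 0 _ _ w≢y _ _ _ _ = ⊥-elim (w≢y refl)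
two-≥2-among-four-distinct 1 _ 1 _ _ w≢y _ _ _ _ = ⊥-elim (w≢y refl)
two-≥2-among-four-distinct 0 _ _ 0 _ _ w≢z _ _ _ = ⊥-elim (w≢z refl)
two-≥2-among-four-distinct 1 _ _ 1 _ _ w≢z _ _ _ = ⊥-elim (w≢z refl)
two-≥2-among-four-distinct _ 0 0 _ _ _ _ x≢y _ _ = ⊥-elim (x≢y refl)
two-≥2-among-four-distinct _ 1 1 _ _ _ _ x≢y _ _ = ⊥-elim (x≢y refl)
two-≥2-among-four-distinct _ 0 _ 0 _ _ _ _ x≢z _ = ⊥-elim (x≢z refl)
two-≥2-among-four-distinct _ 1 _ 1 _ _ _ _ x≢z _ = ⊥-elim (x≢z refl)
two-≥2-among-four-distinct _ _ 0 0 _ _ _ _ _ y≢z = ⊥-elim (y≢z refl)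
two-≥2-among-four-distinct _ _ 1 1 _ _ _ _ _ y≢z = ⊥-elim (y≢z refl)

lemma12 : (n : ℕ) → 5 ≤ n → (u : Vertex n) → Odd u →
            ¬ P4GraphOfNeighbourhoodHasK4 n u
lemma12 _ _ u odd (a , b , c , d , (xa , ua) , (xb , ub) , (xc , uc) , (xd , ud) ,
                   a≢b , a≢c , a≢d , b≢c , b≢d , c≢d , pab , pac , pad , pbc , pbd , pcd)
  with two-≥2-among-four-distinct xa xb xc xd
         (AdjAlong-≢⇒dimension-≢ u ua ub a≢b) (AdjAlong-≢⇒dimension-≢ u ua uc a≢c)
         (AdjAlong-≢⇒dimension-≢ u ua ud a≢d) (AdjAlong-≢⇒dimension-≢ u ub uc b≢c)
         (AdjAlong-≢⇒dimension-≢ u ub ud b≢d) (AdjAlong-≢⇒dimension-≢ u uc ud c≢d)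
... | inj₁ (ha , hb)                               = odd-high-neighbours-¬P4 u odd ha hb ua ub pab
... | inj₂ (inj₁ (ha , hc))                        = odd-high-neighbours-¬P4 u odd ha hc ua uc pac
... | inj₂ (inj₂ (inj₁ (ha , hd)))                 = odd-high-neighbours-¬P4 u odd ha hd ua ud pad
... | inj₂ (inj₂ (inj₂ (inj₁ (hb , hc))))          = odd-high-neighbours-¬P4 u odd hb hc ub uc pbc
... | inj₂ (inj₂ (inj₂ (inj₂ (inj₁ (hb , hd)))))   = odd-high-neighbours-¬P4 u odd hb hd ub ud pbd
... | inj₂ (inj₂ (inj₂ (inj₂ (inj₂ (hc , hd)))))   = odd-high-neighbours-¬P4 u odd hc hd uc ud pcd
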